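{- Let $P$ be a path connected finite space. Then $\mathrm{CC}(P)\le \mathrm{cat}_P^*(P\times P)$, where $P\times P$ is regarded as a fiberwise pointed space over $P$ via the second projection $\mathrm{pr}_2:P\times P\to P$ and the diagonal section $\Delta:P\to P\times P$.
   Context: A finite space is a finite $T_0$ topological space, identified with a finite poset (open sets are down-sets; continuous maps are order-preserving maps). $J_m$ is the finite fence on $\{0,\dots,m\}$ with order $0<1>2<\cdots m$; $P^{J_m}$ is the finite space of continuous maps $J_m\to P$ with the pointwise order; $q_m(\gamma)=(\gamma(0),\gamma(m))$. $\mathrm{CC}_m(P)$ is the smallest $n\ge0$ such that some open cover $\{Q_i\}_{i=1}^n$ of $P\times P$ admits continuous sections $Q_i\to P^{J_m}$ of $q_m$ ($\infty$ if none), and $\mathrm{CC}(P)=\min_{m\ge 0}\mathrm{CC}_m(P)$. For a fiberwise pointed space $X$ over $B$ with projection $p:X\to B$ and section $s:B\to X$, the (unreduced) fiberwise unpointed LS-category $\mathrm{cat}_B^*(X)$ is the smallest $n\ge0$ such that $X$ has an open cover $\{U_i\}_{i=1}^n$ where each $U_i$ is fiberwise compressible into $s(B)$ in $X$, i.e. there is a homotopy $H:U_i\times[0,1]\to X$ with $H(u,0)=u$, $p(H(u,t))=p(u)$ for all $u,t$, and $H(u,1)\in s(B)$ for all $u$ ($\infty$ if no such $n$ exists). -}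

module Defs where

open import Data.Nat using (ℕ; zero; suc; _%_)
open import Data.Fin using (Fin; toℕ; fromℕ; inject₁) renaming (zero to fzero; suc to fsuc)
open import Data.Product using (Σ; ∃; _×_; _,_; proj₁; proj₂)
open import Data.Sum using (_⊎_)
open import Relation.Binary.PropositionalEquality using (_≡_)
open import Relation.Binary.Structures using (IsPartialOrder)

-- Finite T0 spaces = finite posets (open sets = down-sets,
-- continuous maps = order-preserving maps).

record FiniteSpace : Set₁ where
  field
    size           : ℕ
    _≼_            : Fin size → Fin size → Set
    isPartialOrder : IsPartialOrder _≡_ _≼_

  Pt : Set
  Pt = Fin size

IsOpen : {X : Set} → (X → X → Set) → (X → Set) → Set
IsOpen {X} _≤_ U = ∀ {x y : X} → y ≤ x → U x → U y

Monotone : {X Y : Set} → (X → X → Set) → (Y → Y → Set) → (X → Y) → Set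
Monotone _≤X_ _≤Y_ f = ∀ {x y} → x ≤X y → f x ≤Y f y

_×ʳ_ : {X Y : Set} → (X → X → Set) → (Y → Y → Set) → (X × Y → X × Y → Set)
(R ×ʳ S) (x , y) (x' , y') = R x x' × S y y'

-- The finite fence J_m on {0,…,m}: 0 < 1 > 2 < 3 > …
-- (odd points are maximal, even points minimal).

Odd : ℕ → Set
Odd n = n % 2 ≡ 1

Adjacent : {m : ℕ} → Fin (suc m) → Fin (suc m) → Set
Adjacent i j = suc (toℕ i) ≡ toℕ j ⊎ suc (toℕ j) ≡ toℕ i

_≤J_ : {m : ℕ} → Fin (suc m) → Fin (suc m) → Set
i ≤J j = i ≡ j ⊎ (Adjacent i j × Odd (toℕ j))

module _ (P : FiniteSpace) where
  open FiniteSpace P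

  PathSpace : ℕ → Set
  PathSpace m = Σ (Fin (suc m) → Pt) (Monotone (_≤J_ {m}) _≼_)

  _≼ᴾ_ : {m : ℕ} → PathSpace m → PathSpace m → Set
  γ ≼ᴾ δ = ∀ i → proj₁ γ i ≼ proj₁ δ i

  qm : (m : ℕ) → PathSpace m → Pt × Pt
  qm m γ = proj₁ γ fzero , proj₁ γ (fromℕ m)

  -- path connectedness of the finite space P (paths in P are fences)
  PathConnected : Set
  PathConnected = ∀ (x y : Pt) → ∃ λ m → Σ (PathSpace m) λ γ → qm m γ ≡ (x , y)

  HasSection : (m : ℕ) → (Pt × Pt → Set) → Set
  HasSection m Q =
    Σ ((u : Pt × Pt) → Q u → PathSpace m) λ s →
      (∀ u (qu : Q u) → qm m (s u qu) ≡ u)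
    × (∀ u v (qu : Q u) (qv : Q v) → (_≼_ ×ʳ _≼_) u v → s u qu ≼ᴾ s v qv)

  CCm≤ : ℕ → ℕ → Set₁
  CCm≤ m n =
    Σ (Fin n → Pt × Pt → Set) λ Q →
      (∀ i → IsOpen (_≼_ ×ʳ _≼_) (Q i))
    × (∀ u → ∃ λ i → Q i u)
    × (∀ i → HasSection m (Q i))

  CC≤ : ℕ → Set₁
  CC≤ n = ∃ λ m → CCm≤ m n

-- A homotopy
-- U × [0,1] → X of maps from the finite space U is encoded as a finite
-- fence of continuous maps H_0, …, H_r : U → X with consecutive maps
-- comparable in the pointwise order (standard finite-space homotopy).

FiberwiseCompressible : {X B : Set} → (X → X → Set) → (X → B) → (B → X) →
                        (X → Set) → Set
FiberwiseCompressible {X} {B} _≤X_ p s U =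
  ∃ λ (r : ℕ) → Σ (Fin (suc r) → (x : X) → U x → X) λ H →
      (∀ j x y (ux : U x) (uy : U y) → x ≤X y → H j x ux ≤X H j y uy)
    × (∀ x (ux : U x) → H fzero x ux ≡ x)
    × (∀ j x (ux : U x) → p (H j x ux) ≡ p x)
    × (∀ (j : Fin r) →
          (∀ x (ux : U x) → H (inject₁ j) x ux ≤X H (fsuc j) x ux)
        ⊎ (∀ x (ux : U x) → H (fsuc j) x ux ≤X H (inject₁ j) x ux))
    × (∀ x (ux : U x) → ∃ λ (b : B) → H (fromℕ r) x ux ≡ s b)

Cat*≤ : {X B : Set} → (X → X → Set) → (X → B) → (B → X) → ℕ → Set₁
Cat*≤ {X} _≤X_ p s n =
  Σ (Fin n → X → Set) λ U →
      (∀ i → IsOpen _≤X_ (U i))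
    × (∀ x → ∃ λ i → U i x)
    × (∀ i → FiberwiseCompressible _≤X_ p s (U i))

Δ : {A : Set} → A → A × A
Δ a = a , a

CatPP≤ : (P : FiniteSpace) → ℕ → Set₁
CatPP≤ P n = Cat*≤ (_≼_ ×ʳ _≼_) proj₂ Δ n
  where open FiniteSpace P

{-# OPTIONS --safe #-}

-- Restricted to first coordinates, a fiberwise compression of an open set
-- U ⊆ P × P is a finite zigzag of monotone maps h₀ ≤≥ h₁ ≤≥ ⋯ ≤≥ hᵣ : U → P with
-- h₀(x , y) = x and hᵣ(x , y) = y, since the second coordinate is fixed and
-- the last stage lies on the diagonal.  Inserting at every step the larger of
-- the two neighbouring maps turns the zigzag into a fence of length 2r, which
-- is a continuous section of q_{2r} over U; padding with hᵣ makes all the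
-- sections of a cover share one length.

module Submission where

open import Defs
open import Data.Nat using (ℕ; zero; suc; _+_; _*_; _/_; _≤_; s≤s)
open import Data.Nat.Properties using (≤-totalOrder; *-monoˡ-≤)
open import Data.Nat.DivMod using (m≡m%n+[m/n]*n)
open import Data.Fin using (Fin; toℕ; fromℕ; inject₁) renaming (zero to fzero; suc to fsuc)
open import Data.Fin.Properties using (toℕ-fromℕ)
open import Data.List using (tabulate)
open import Data.List.Extrema ≤-totalOrder using (max; xs≤max)
open import Data.List.Relation.Unary.All.Properties using (tabulate⁻)
open import Data.Product using (∃; _×_; _,_; proj₁; proj₂)
import Data.Product as Product
open import Data.Sum using (_⊎_; inj₁; inj₂)
import Data.Sum as Sum
open import Function using (_∘_)
open import Relation.Binary.Definitions using (Reflexive)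
open import Relation.Binary.PropositionalEquality using (_≡_; refl; cong; cong₂; trans; sym; subst; module ≡-Reasoning)
open import Relation.Binary.Structures using (IsPartialOrder)

odd⇒≡suc[half*2] : ∀ {n} → Odd n → n ≡ suc (n / 2 * 2)
odd⇒≡suc[half*2] {n} odd = trans (m≡m%n+[m/n]*n n 2) (cong (_+ n / 2 * 2) odd)

≤max-tabulate : ∀ {n} (f : Fin n → ℕ) i → f i ≤ max 0 (tabulate f)
≤max-tabulate f = tabulate⁻ (xs≤max 0 (tabulate f))

module Zigzag {A : Set} (_⊑_ : A → A → Set) where

  IsZigzag : (r : ℕ) → (Fin (suc r) → A) → Set
  IsZigzag r h = ∀ (j : Fin r) → h (inject₁ j) ⊑ h (fsuc j) ⊎ h (fsuc j) ⊑ h (inject₁ j)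

  IsFence : (ℕ → A) → Set
  IsFence g = ∀ k → g (k * 2) ⊑ g (suc (k * 2)) × g (suc (suc (k * 2))) ⊑ g (suc (k * 2))

  upper : ∀ {x y} → x ⊑ y ⊎ y ⊑ x → A
  upper {y = y} (inj₁ _) = y
  upper {x = x} (inj₂ _) = x

  toFence : ∀ r h → IsZigzag r h → ℕ → A
  toFence zero    h z _             = h fzero
  toFence (suc r) h z zero          = h fzero
  toFence (suc r) h z (suc zero)    = upper (z fzero)
  toFence (suc r) h z (suc (suc k)) = toFence r (h ∘ fsuc) (z ∘ fsuc) k

  toFence-zero : ∀ r h z → toFence r h z 0 ≡ h fzero
  toFence-zero zero    h z = refl
  toFence-zero (suc r) h z = refl

  toFence-end : ∀ r h z {k} → r * 2 ≤ k → toFence r h z k ≡ h (fromℕ r)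
  toFence-end zero    h z _               = refl
  toFence-end (suc r) h z (s≤s (s≤s r≤k)) = toFence-end r (h ∘ fsuc) (z ∘ fsuc) r≤k

  toFence-all : ∀ (Q : A → Set) r h z → (∀ j → Q (h j)) → ∀ k → Q (toFence r h z k)
  toFence-all Q zero    h z Qh k             = Qh fzero
  toFence-all Q (suc r) h z Qh zero          = Qh fzero
  toFence-all Q (suc r) h z Qh (suc zero)    with z fzero
  ... | inj₁ _ = Qh (fsuc fzero)
  ... | inj₂ _ = Qh fzero
  toFence-all Q (suc r) h z Qh (suc (suc k)) = toFence-all Q r (h ∘ fsuc) (z ∘ fsuc) (Qh ∘ fsuc) k

  module _ (⊑-refl : Reflexive _⊑_) where

    toFence-isFence : ∀ r h z → IsFence (toFence r h z)
    toFence-isFence zero          h z k       = ⊑-refl , ⊑-refl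
    toFence-isFence (suc zero)    h z zero    with z fzero
    ... | inj₁ h₀≤h₁ = h₀≤h₁ , ⊑-refl
    ... | inj₂ h₁≤h₀ = ⊑-refl , h₁≤h₀
    toFence-isFence (suc (suc r)) h z zero    with z fzero
    ... | inj₁ h₀≤h₁ = h₀≤h₁ , ⊑-refl
    ... | inj₂ h₁≤h₀ = ⊑-refl , h₁≤h₀
    toFence-isFence (suc r)       h z (suc k) = toFence-isFence r (h ∘ fsuc) (z ∘ fsuc) k

    fence-peak : ∀ {g} → IsFence g → ∀ {i} k →
                 suc i ≡ suc (k * 2) ⊎ suc (suc (k * 2)) ≡ i → g i ⊑ g (suc (k * 2))
    fence-peak F k (inj₁ refl) = proj₁ (F k)
    fence-peak F k (inj₂ refl) = proj₂ (F k)

    isFence⇒monotone : ∀ g → IsFence g → ∀ {m} → Monotone (_≤J_ {m}) _⊑_ (g ∘ toℕ)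
    isFence⇒monotone g F (inj₁ refl) = ⊑-refl
    isFence⇒monotone g F {x = i} {j} (inj₂ (adjacent , odd)) =
      subst (λ b → suc (toℕ i) ≡ b ⊎ suc b ≡ toℕ i → g (toℕ i) ⊑ g b)
            (sym (odd⇒≡suc[half*2] odd)) (fence-peak {g} F (toℕ j / 2)) adjacent

open Zigzag

≡Δ⇒proj₁≡proj₂ : ∀ {A : Set} {w : A × A} → ∃ (λ b → w ≡ Δ b) → proj₁ w ≡ proj₂ w
≡Δ⇒proj₁≡proj₂ (_ , refl) = refl

module _ (P : FiniteSpace) where
  open FiniteSpace P

  private
    ≼-refl : Reflexive _≼_
    ≼-refl = IsPartialOrder.refl isPartialOrder

  compressible⇒hasSection : ∀ {U k} (c : FiberwiseCompressible (_≼_ ×ʳ _≼_) proj₂ Δ U) →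
                            proj₁ c ≤ k → HasSection P (k * 2) U
  compressible⇒hasSection {U} {k} (r , H , H-mono , H-start , H-fiber , H-steps , H-end) r≤k =
    path , path-endpoints , path-mono
    where
    Map : Set
    Map = ∀ u → U u → Pt

    _≤ᴹ_ : Map → Map → Set
    f ≤ᴹ g = ∀ u (qu : U u) → f u qu ≼ g u qu

    h : Fin (suc r) → Map
    h j u qu = proj₁ (H j u qu)

    h-zigzag : IsZigzag _≤ᴹ_ r h
    h-zigzag j = Sum.map (λ H≤ u qu → proj₁ (H≤ u qu)) (λ H≥ u qu → proj₁ (H≥ u qu)) (H-steps j)

    γ : ℕ → Map
    γ = toFence _≤ᴹ_ r h h-zigzag

    γ-at : ∀ u (qu : U u) → IsFence _≼_ (λ t → γ t u qu)
    γ-at u qu t = Product.map (λ le → le u qu) (λ le → le u qu)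
                    (toFence-isFence _≤ᴹ_ (λ _ _ → ≼-refl) r h h-zigzag t)

    path : ∀ u → U u → PathSpace P (k * 2)
    path u qu = (λ t → γ (toℕ t) u qu) , isFence⇒monotone _≼_ ≼-refl (λ t → γ t u qu) (γ-at u qu)

    path-endpoints : ∀ u (qu : U u) → qm P (k * 2) (path u qu) ≡ u
    path-endpoints u qu = cong₂ _,_ start end
      where
      start : γ 0 u qu ≡ proj₁ u
      start = trans (cong (λ f → f u qu) (toFence-zero _≤ᴹ_ r h h-zigzag))
                    (cong proj₁ (H-start u qu))
      end : γ (toℕ (fromℕ (k * 2))) u qu ≡ proj₂ u
      end = begin
        γ (toℕ (fromℕ (k * 2))) u qu ≡⟨ cong (λ t → γ t u qu) (toℕ-fromℕ (k * 2)) ⟩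
        γ (k * 2) u qu               ≡⟨ cong (λ f → f u qu) (toFence-end _≤ᴹ_ r h h-zigzag (*-monoˡ-≤ 2 r≤k)) ⟩
        proj₁ (H (fromℕ r) u qu)     ≡⟨ ≡Δ⇒proj₁≡proj₂ (H-end u qu) ⟩
        proj₂ (H (fromℕ r) u qu)     ≡⟨ H-fiber (fromℕ r) u qu ⟩
        proj₂ u                      ∎
        where open ≡-Reasoning

    path-mono : ∀ u v (qu : U u) (qv : U v) → (_≼_ ×ʳ _≼_) u v → _≼ᴾ_ P (path u qu) (path v qv)
    path-mono u v qu qv u≤v t =
      toFence-all _≤ᴹ_ (λ f → f u qu ≼ f v qv) r h h-zigzag
        (λ j → proj₁ (H-mono j u v qu qv u≤v)) (toℕ t)

proposition3p5 : (P : FiniteSpace) → PathConnected P →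
    (n : ℕ) → CatPP≤ P n → CC≤ P n
proposition3p5 P _ n (U , U-open , U-cover , U-compressible) =
  length * 2 , U , U-open , U-cover ,
  λ i → compressible⇒hasSection P (U-compressible i) (≤max-tabulate stages i)
  where
  stages : Fin n → ℕ
  stages i = proj₁ (U-compressible i)

  length : ℕ
  length = max 0 (tabulate stages)
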